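{- Suppose $(\Gamma,\Omega)$ is a consistent pair and $\sigma'$ is a signature such that $\Gamma,\Omega\subseteq\mathcal{L}(\sigma')$ and $\sigma'^\nu$ contains infinitely many constants not appearing in any formula of $\Gamma$ or $\Omega$. Then there exists a saturated theory $\Gamma'$ over $\mathcal{L}(\sigma')$ such that $\Gamma\subseteq\Gamma'$ and $\Omega\cap\Gamma'=\varnothing$.
   Context: A signature $\sigma=(\sigma^\nu,\sigma^\pi,\sigma^\alpha)$ has a countably infinite set $\sigma^\nu$ of constants, a countable set $\sigma^\pi$ of predicate symbols and arities $\sigma^\alpha:\sigma^\pi\to\mathbb{N}_{>0}$; $\mathcal{L}(\sigma)$ is the set of sentences of the first-order modal language with $\doteq,\land,\lor,\to,\Box,\Diamond,\forall,\exists,\bot$. Provability $\vdash$ is in the Hilbert system $\mathsf{FOFS}$ over $\sigma'$, with axioms: substitution instances of intuitionistic propositional tautologies; $\Box(\phi\land\psi)\leftrightarrow(\Box\phi\land\Box\psi)$; $\Box\top$; $\Diamond(\phi\lor\psi)\leftrightarrow(\Diamond\phi\lor\Diamond\psi)$; $\neg\Diamond\bot$; $(\Diamond\phi\to\Box\psi)\to\Box(\phi\to\psi)$; $\Diamond(\phi\to\psi)\to(\Box\phi\to\Diamond\psi)$; $\forall x\phi(x)\to\phi(c)$; $\phi(c)\to\exists x\phi(x)$; $\forall x(\phi(x)\to\psi)\to(\exists x\phi(x)\to\psi)$; $\forall x(\phi\to\psi(x))\to(\phi\to\forall x\psi(x))$; $c\doteq c$; $c_1\doteq c_2\to(\phi(c_1)\to\phi(c_2))$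 for modal-free $\phi$ (where $\phi(x)$ has exactly one free variable); rules modus ponens, from $\phi(c)$ infer $\forall x\phi(x)$, and from $\phi\to\psi$ infer $\Box\phi\to\Box\psi$ and $\Diamond\phi\to\Diamond\psi$. $\Gamma\vdash\phi$ means $\vdash\bigwedge_i\gamma_i\to\phi$ for some finite $\{\gamma_i\}\subseteq\Gamma$. A pair $(\Gamma,\Omega)$ of sets of sentences is consistent if there is no finite $\{\omega_i\}\subseteq\Omega$ with $\Gamma\vdash\bigvee_i\omega_i$. A set $\Gamma'\subseteq\mathcal{L}(\sigma')$ is a saturated theory if $\Gamma'\nvdash\bot$; $\Gamma'\vdash\phi$ implies $\phi\in\Gamma'$ for $\phi\in\mathcal{L}(\sigma')$; $\phi\lor\psi\in\Gamma'$ implies $\phi\in\Gamma'$ or $\psi\in\Gamma'$; and $\exists x\phi(x)\in\Gamma'$ implies $\phi(c)\in\Gamma'$ for some constant $c\in\sigma'^\nu$. -}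

module Defs where

open import Level using (0ℓ)
open import Data.Nat using (ℕ; zero; suc; _<_)
open import Data.Fin using (Fin; zero; suc)
open import Data.Vec using (Vec; []; _∷_)
open import Data.List using (List; []; _∷_; foldr)
open import Data.List.Relation.Unary.All using (All)
open import Data.List.Relation.Unary.Any using (Any)
open import Data.Vec.Relation.Unary.Any as VAny using ()
open import Data.Product using (Σ; ∃; _×_; _,_)
open import Data.Sum using (_⊎_)
open import Data.Empty using (⊥)
open import Data.Unit using (⊤)
open import Function.Bundles using (_↔_; _↣_)
open import Relation.Nullary using (¬_)
open import Relation.Unary using (Pred)
open import Relation.Binary.PropositionalEquality using (_≡_)

record Signature : Set₁ where
  field
    Const      : Set
    constCount : Const ↔ ℕ
    PredSym    : Set
    predCount  : PredSym ↣ ℕ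
    arity      : PredSym → ℕ
    arityPos   : ∀ p → 0 < arity p

-- Syntax (well-scoped de Bruijn: a formula in context n has at most n
-- free variables; sentences are formulas in context 0).

module Syntax (σ : Signature) where
  open Signature σ

  data Term (n : ℕ) : Set where
    var   : Fin n → Term n
    const : Const → Term n

  infixr 6 _∧'_
  infixr 5 _∨'_
  infixr 4 _⇒_
  infix  7 _≐_

  data Formula (n : ℕ) : Set where
    atom : (p : PredSym) → Vec (Term n) (arity p) → Formula n
    _≐_  : Term n → Term n → Formula n
    ⊥'   : Formula n
    _∧'_ : Formula n → Formula n → Formula n
    _∨'_ : Formula n → Formula n → Formula n
    _⇒_  : Formula n → Formula n → Formula n
    □    : Formula n → Formula n
    ◇    : Formula n → Formula n
    ∀'   : Formula (suc n) → Formula n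
    ∃'   : Formula (suc n) → Formula n

  Sentence : Set
  Sentence = Formula 0

  ⊤' : ∀ {n} → Formula n
  ⊤' = ⊥' ⇒ ⊥'

  ¬' : ∀ {n} → Formula n → Formula n
  ¬' φ = φ ⇒ ⊥'

  _⇔_ : ∀ {n} → Formula n → Formula n → Formula n
  φ ⇔ ψ = (φ ⇒ ψ) ∧' (ψ ⇒ φ)

  Subst : ℕ → ℕ → Set
  Subst n m = Fin n → Term m

  renT : ∀ {n m} → (Fin n → Fin m) → Term n → Term m
  renT ρ (var i)   = var (ρ i)
  renT ρ (const c) = const c

  liftS : ∀ {n m} → Subst n m → Subst (suc n) (suc m)
  liftS s zero    = var zero
  liftS s (suc i) = renT suc (s i)

  substT : ∀ {n m} → Subst n m → Term n → Term m
  substT s (var i)   = s i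
  substT s (const c) = const c

  substTs : ∀ {n m k} → Subst n m → Vec (Term n) k → Vec (Term m) k
  substTs s []       = []
  substTs s (t ∷ ts) = substT s t ∷ substTs s ts

  subst : ∀ {n m} → Subst n m → Formula n → Formula m
  subst s (atom p ts) = atom p (substTs s ts)
  subst s (t ≐ u)     = substT s t ≐ substT s u
  subst s ⊥'          = ⊥'
  subst s (φ ∧' ψ)    = subst s φ ∧' subst s ψ
  subst s (φ ∨' ψ)    = subst s φ ∨' subst s ψ
  subst s (φ ⇒ ψ)     = subst s φ ⇒ subst s ψ
  subst s (□ φ)       = □ (subst s φ)
  subst s (◇ φ)       = ◇ (subst s φ)
  subst s (∀' φ)      = ∀' (subst (liftS s) φ)
  subst s (∃' φ)      = ∃' (subst (liftS s) φ)

  _[_] : Formula 1 → Const → Sentence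
  φ [ c ] = subst (λ _ → const c) φ

  wk : Sentence → Formula 1
  wk = subst (λ ())

  data OccursT (c : Const) {n : ℕ} : Term n → Set where
    here : OccursT c (const c)

  data Occurs (c : Const) {n : ℕ} : Formula n → Set where
    inAtom : ∀ {p ts} → VAny.Any (OccursT c) ts → Occurs c (atom p ts)
    inEqˡ  : ∀ {t u} → OccursT c t → Occurs c (t ≐ u)
    inEqʳ  : ∀ {t u} → OccursT c u → Occurs c (t ≐ u)
    ∧ˡ : ∀ {φ ψ} → Occurs c φ → Occurs c (φ ∧' ψ)
    ∧ʳ : ∀ {φ ψ} → Occurs c ψ → Occurs c (φ ∧' ψ)
    ∨ˡ : ∀ {φ ψ} → Occurs c φ → Occurs c (φ ∨' ψ)
    ∨ʳ : ∀ {φ ψ} → Occurs c ψ → Occurs c (φ ∨' ψ)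
    ⇒ˡ : ∀ {φ ψ} → Occurs c φ → Occurs c (φ ⇒ ψ)
    ⇒ʳ : ∀ {φ ψ} → Occurs c ψ → Occurs c (φ ⇒ ψ)
    in□ : ∀ {φ} → Occurs c φ → Occurs c (□ φ)
    in◇ : ∀ {φ} → Occurs c φ → Occurs c (◇ φ)
    in∀ : ∀ {φ} → Occurs c φ → Occurs c (∀' φ)
    in∃ : ∀ {φ} → Occurs c φ → Occurs c (∃' φ)

  data ModalFree {n : ℕ} : Formula n → Set where
    mfAtom : ∀ {p ts} → ModalFree (atom p ts)
    mfEq   : ∀ {t u} → ModalFree (t ≐ u)
    mf⊥    : ModalFree ⊥'
    mf∧ : ∀ {φ ψ} → ModalFree φ → ModalFree ψ → ModalFree (φ ∧' ψ)
    mf∨ : ∀ {φ ψ} → ModalFree φ → ModalFree ψ → ModalFree (φ ∨' ψ)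
    mf⇒ : ∀ {φ ψ} → ModalFree φ → ModalFree ψ → ModalFree (φ ⇒ ψ)
    mf∀ : ∀ {φ} → ModalFree φ → ModalFree (∀' φ)
    mf∃ : ∀ {φ} → ModalFree φ → ModalFree (∃' φ)

infixr 6 _p∧_
infixr 5 _p∨_
infixr 4 _p⇒_

data PForm : Set where
  pvar : ℕ → PForm
  p⊥   : PForm
  _p∧_ : PForm → PForm → PForm
  _p∨_ : PForm → PForm → PForm
  _p⇒_ : PForm → PForm → PForm

data IPC : PForm → Set where
  ax-K   : ∀ A B → IPC (A p⇒ B p⇒ A)
  ax-S   : ∀ A B C → IPC ((A p⇒ B p⇒ C) p⇒ (A p⇒ B) p⇒ A p⇒ C)
  ax-∧I  : ∀ A B → IPC (A p⇒ B p⇒ A p∧ B)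
  ax-∧E₁ : ∀ A B → IPC (A p∧ B p⇒ A)
  ax-∧E₂ : ∀ A B → IPC (A p∧ B p⇒ B)
  ax-∨I₁ : ∀ A B → IPC (A p⇒ A p∨ B)
  ax-∨I₂ : ∀ A B → IPC (B p⇒ A p∨ B)
  ax-∨E  : ∀ A B C → IPC ((A p⇒ C) p⇒ (B p⇒ C) p⇒ A p∨ B p⇒ C)
  ax-⊥E  : ∀ A → IPC (p⊥ p⇒ A)
  mp     : ∀ {A B} → IPC (A p⇒ B) → IPC A → IPC B

module FOFS (σ : Signature) where
  open Signature σ
  open Syntax σ public

  inst : (ℕ → Sentence) → PForm → Sentence
  inst v (pvar i) = v i
  inst v p⊥       = ⊥'
  inst v (A p∧ B) = inst v A ∧' inst v B
  inst v (A p∨ B) = inst v A ∨' inst v B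
  inst v (A p⇒ B) = inst v A ⇒ inst v B

  infix 2 ⊢_

  data ⊢_ : Sentence → Set where
    taut    : ∀ {A} → IPC A → (v : ℕ → Sentence) → ⊢ inst v A
    □∧      : ∀ φ ψ → ⊢ □ (φ ∧' ψ) ⇔ (□ φ ∧' □ ψ)
    □⊤      : ⊢ □ ⊤'
    ◇∨      : ∀ φ ψ → ⊢ ◇ (φ ∨' ψ) ⇔ (◇ φ ∨' ◇ ψ)
    ¬◇⊥     : ⊢ ¬' (◇ ⊥')
    FS1     : ∀ φ ψ → ⊢ (◇ φ ⇒ □ ψ) ⇒ □ (φ ⇒ ψ)
    FS2     : ∀ φ ψ → ⊢ ◇ (φ ⇒ ψ) ⇒ (□ φ ⇒ ◇ ψ)
    ∀E      : ∀ (φ : Formula 1) c → ⊢ ∀' φ ⇒ φ [ c ]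
    ∃I      : ∀ (φ : Formula 1) c → ⊢ φ [ c ] ⇒ ∃' φ
    ∃E      : ∀ (φ : Formula 1) (ψ : Sentence) →
              ⊢ ∀' (φ ⇒ wk ψ) ⇒ (∃' φ ⇒ ψ)
    ∀I      : ∀ (φ : Sentence) (ψ : Formula 1) →
              ⊢ ∀' (wk φ ⇒ ψ) ⇒ (φ ⇒ ∀' ψ)
    refl≐   : ∀ c → ⊢ const c ≐ const c
    Leibniz : ∀ (φ : Formula 1) c₁ c₂ → ModalFree φ →
              ⊢ const c₁ ≐ const c₂ ⇒ (φ [ c₁ ] ⇒ φ [ c₂ ])
    MP      : ∀ {φ ψ} → ⊢ φ ⇒ ψ → ⊢ φ → ⊢ ψ
    Gen     : ∀ (φ : Formula 1) c → ¬ Occurs c φ → ⊢ φ [ c ] → ⊢ ∀' φ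
    Mon□    : ∀ {φ ψ} → ⊢ φ ⇒ ψ → ⊢ □ φ ⇒ □ ψ
    Mon◇    : ∀ {φ ψ} → ⊢ φ ⇒ ψ → ⊢ ◇ φ ⇒ ◇ ψ

  Sentences : Set₁
  Sentences = Pred Sentence 0ℓ

  ⋀ : List Sentence → Sentence
  ⋀ = foldr _∧'_ ⊤'

  ⋁ : List Sentence → Sentence
  ⋁ = foldr _∨'_ ⊥'

  _⊢_ : Sentences → Sentence → Set
  Γ ⊢ φ = Σ (List Sentence) λ γs → All Γ γs × (⊢ ⋀ γs ⇒ φ)

  ConsistentPair : Sentences → Sentences → Set
  ConsistentPair Γ Ω =
    ¬ (Σ (List Sentence) λ ωs → All Ω ωs × (Γ ⊢ ⋁ ωs))

  record Saturated (Γ : Sentences) : Set where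
    field
      consistent : ¬ (Γ ⊢ ⊥')
      closed     : ∀ φ → Γ ⊢ φ → Γ φ
      prime      : ∀ φ ψ → Γ (φ ∨' ψ) → Γ φ ⊎ Γ ψ
      witnessed  : ∀ (φ : Formula 1) → Γ (∃' φ) → ∃ λ c → Γ (φ [ c ])

  FreshFor : Const → Sentences → Set
  FreshFor c Δ = ∀ φ → Δ φ → ¬ Occurs c φ

-- A Lindenbaum construction for consistent pairs. Enumerate all sentences
-- ψ₀, ψ₁, … (sentences are countable, coded by naturals) and grow the pair
-- (Γ, Ω) one sentence at a time: ψₙ goes to the left if that keeps the pair
-- consistent, otherwise to the right, which is then consistent by a cut
-- argument. When an existential ∃x φ goes to the left it is accompanied by a
-- witness φ(c) for a constant c occurring nowhere so far; this keeps the pair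
-- consistent because φ(c) ⊢ χ with c fresh yields ∃x φ ⊢ χ. Such a c exists
-- among the infinitely many constants fresh for Γ ∪ Ω, since the finitely
-- many sentences added so far mention only finitely many of them. The union
-- of the chain is a consistent pair containing every sentence on one side,
-- so its left component is deductively closed and prime.
module Submission where

open import Defs
open import Level using (0ℓ)
open import Data.Nat using (ℕ; zero; suc; _≤_; _⊔_; _≤′_; ≤′-refl; ≤′-step)
open import Data.Nat.Properties using (≤-refl; ≤-trans; ≤⇒≤′; m≤m⊔n; m≤n⊔m; <⇒≢)
open import Data.Nat.Binary using (ℕᵇ; 2[1+_]; 1+[2_]) renaming (zero to 0ᵇ; toℕ to toℕᵇ)
open import Data.Nat.Binary.Properties using (2[1+_]-injective; 1+[2_]-injective)
  renaming (toℕ-injective to toℕᵇ-injective)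
open import Data.Fin as Fin using (zero; suc; toℕ)
open import Data.Fin.Properties using (toℕ-injective)
open import Data.Vec using (Vec; []; _∷_)
open import Data.Vec.Relation.Unary.Any as VAny using ()
open import Data.List using (List; []; _∷_; _++_)
open import Data.List.Relation.Unary.All as All using (All; []; _∷_)
open import Data.List.Relation.Unary.All.Properties using (++⁺; ++⁻ˡ; ++⁻ʳ; ¬Any⇒All¬)
open import Data.List.Relation.Unary.Any as Any using (Any)
open import Data.Product using (Σ; ∃; _×_; _,_; proj₁)
open import Data.Sum using (_⊎_; inj₁; inj₂; [_,_]′)
open import Data.Empty using (⊥; ⊥-elim)
open import Function using (id; _∘_)
open import Function.Bundles using (_↣_; Injection; Inverse)
open import Function.Properties.Inverse using (↔⇒↣)
open import Relation.Nullary using (¬_; Dec; yes; no)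
open import Relation.Unary using (Pred; _⊆_; _∪_; ∅; ⋃)
open import Relation.Binary.PropositionalEquality
  using (_≡_; refl; sym; trans; cong; cong₂) renaming (subst to transport)
open import Axiom.ExcludedMiddle using (ExcludedMiddle)

data Tree : Set where
  leaf : ℕ → Tree
  node : Tree → Tree → Tree

-- Prefix codes: r can be read back off the end of the result.
unary : ℕ → ℕᵇ → ℕᵇ
unary zero    r = 1+[2 r ]
unary (suc k) r = 2[1+ unary k r ]

serialise : Tree → ℕᵇ → ℕᵇ
serialise (leaf k)   r = 1+[2 unary k r ]
serialise (node s t) r = 2[1+ serialise s (serialise t r) ]

unary-injective : ∀ k l {r r′} → unary k r ≡ unary l r′ → k ≡ l × r ≡ r′
unary-injective zero    zero    e = refl , 1+[2_]-injective e
unary-injective (suc k) (suc l) e with unary-injective k l (2[1+_]-injective e)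
... | refl , r≡r′ = refl , r≡r′
unary-injective zero    (suc l) ()
unary-injective (suc k) zero    ()

serialise-injective : ∀ s t {r r′} → serialise s r ≡ serialise t r′ → s ≡ t × r ≡ r′
serialise-injective (leaf k) (leaf l) e with unary-injective k l (1+[2_]-injective e)
... | refl , r≡r′ = refl , r≡r′
serialise-injective (node s₁ s₂) (node t₁ t₂) e
  with serialise-injective s₁ t₁ (2[1+_]-injective e)
... | refl , e′ with serialise-injective s₂ t₂ e′
... | refl , r≡r′ = refl , r≡r′
serialise-injective (leaf k)     (node t₁ t₂) ()
serialise-injective (node s₁ s₂) (leaf l)     ()

-- Opaque: unfolding the numeral of a partly symbolic tree blows up exponentially.
opaque
  treeCode : Tree → ℕ
  treeCode t = toℕᵇ (serialise t 0ᵇ)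

  treeCode-injective : ∀ {s t} → treeCode s ≡ treeCode t → s ≡ t
  treeCode-injective {s} {t} e = proj₁ (serialise-injective s t (toℕᵇ-injective e))

module Enumeration (em : ExcludedMiddle 0ℓ) {A : Set} (default : A) (code : A → ℕ)
                   (code-injective : ∀ {x y} → code x ≡ code y → x ≡ y) where

  decode : ℕ → A
  decode n with em {∃ λ x → code x ≡ n}
  ... | yes (x , _) = x
  ... | no _        = default

  decode-code : ∀ x → decode (code x) ≡ x
  decode-code x with em {∃ λ y → code y ≡ code x}
  ... | yes (y , e) = code-injective e
  ... | no ∄y       = ⊥-elim (∄y (x , refl))

module Chain {A : Set} (S : ℕ → Pred A 0ℓ) (grows : ∀ n → S n ⊆ S (suc n)) where

  ⋃S : Pred A 0ℓ
  ⋃S = ⋃ ℕ S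

  mono : ∀ {m n} → m ≤ n → S m ⊆ S n
  mono m≤n = mono′ (≤⇒≤′ m≤n)
    where
      mono′ : ∀ {m n} → m ≤′ n → S m ⊆ S n
      mono′ ≤′-refl     = id
      mono′ (≤′-step p) = grows _ ∘ mono′ p

  all-in-some-stage : ∀ {xs} → All ⋃S xs → ∃ λ n → All (S n) xs
  all-in-some-stage []             = 0 , []
  all-in-some-stage ((m , p) ∷ ps) with all-in-some-stage ps
  ... | n , qs = m ⊔ n , mono (m≤m⊔n m n) p ∷ All.map (mono (m≤n⊔m m n)) qs

module Eventually (em : ExcludedMiddle 0ℓ) {C : Set} (f : ℕ ↣ C) where
  open Injection f using (to; injective)

  -- A record rather than a Σ-type, so that P can be inferred from its inhabitants.
  record EventuallyAvoided (P : Pred C 0ℓ) : Set where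
    constructor _,_
    field
      bound  : ℕ
      avoids : ∀ k → bound ≤ k → ¬ P (to k)

  avoided-∅ : EventuallyAvoided ∅
  avoided-∅ = 0 , λ _ _ ()

  avoided-∪ : ∀ {P Q} → EventuallyAvoided P → EventuallyAvoided Q → EventuallyAvoided (P ∪ Q)
  avoided-∪ (m , p) (n , q) =
    m ⊔ n , λ k le → [ p k (≤-trans (m≤m⊔n m n) le) , q k (≤-trans (m≤n⊔m m n) le) ]′

  avoided-⊆ : ∀ {P Q} → P ⊆ Q → EventuallyAvoided Q → EventuallyAvoided P
  avoided-⊆ P⊆Q (n , q) = n , λ k le → q k le ∘ P⊆Q

  -- Whether c lies in the image of f is not decidable.
  avoided-≡ : ∀ c → EventuallyAvoided (_≡ c)
  avoided-≡ c with em {∃ λ k → to k ≡ c}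
  ... | yes (k , fk≡c) = suc k , λ j k<j fj≡c → <⇒≢ k<j (injective (trans fk≡c (sym fj≡c)))
  ... | no ∄k          = 0 , λ j _ fj≡c → ∄k (j , fj≡c)

module Hilbert (σ : Signature) where
  open FOFS σ

  private
    valuation : Sentence → Sentence → Sentence → ℕ → Sentence
    valuation φ ψ χ zero          = φ
    valuation φ ψ χ (suc zero)    = ψ
    valuation φ ψ χ (suc (suc _)) = χ

    p q r : PForm
    p = pvar 0
    q = pvar 1
    r = pvar 2

  ⊢K : ∀ {φ ψ} → ⊢ φ ⇒ ψ ⇒ φ
  ⊢K {φ} {ψ} = taut (ax-K p q) (valuation φ ψ φ)

  ⊢S : ∀ {φ ψ χ} → ⊢ (φ ⇒ ψ ⇒ χ) ⇒ (φ ⇒ ψ) ⇒ φ ⇒ χ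
  ⊢S {φ} {ψ} {χ} = taut (ax-S p q r) (valuation φ ψ χ)

  ⊢∧I : ∀ {φ ψ} → ⊢ φ ⇒ ψ ⇒ φ ∧' ψ
  ⊢∧I {φ} {ψ} = taut (ax-∧I p q) (valuation φ ψ φ)

  ⊢∧E₁ : ∀ {φ ψ} → ⊢ φ ∧' ψ ⇒ φ
  ⊢∧E₁ {φ} {ψ} = taut (ax-∧E₁ p q) (valuation φ ψ φ)

  ⊢∧E₂ : ∀ {φ ψ} → ⊢ φ ∧' ψ ⇒ ψ
  ⊢∧E₂ {φ} {ψ} = taut (ax-∧E₂ p q) (valuation φ ψ φ)

  ⊢∨I₁ : ∀ {φ ψ} → ⊢ φ ⇒ φ ∨' ψ
  ⊢∨I₁ {φ} {ψ} = taut (ax-∨I₁ p q) (valuation φ ψ φ)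

  ⊢∨I₂ : ∀ {φ ψ} → ⊢ ψ ⇒ φ ∨' ψ
  ⊢∨I₂ {φ} {ψ} = taut (ax-∨I₂ p q) (valuation φ ψ φ)

  ⊢∨E : ∀ {φ ψ χ} → ⊢ (φ ⇒ χ) ⇒ (ψ ⇒ χ) ⇒ φ ∨' ψ ⇒ χ
  ⊢∨E {φ} {ψ} {χ} = taut (ax-∨E p q r) (valuation φ ψ χ)

  ⊢⊥E : ∀ {φ} → ⊢ ⊥' ⇒ φ
  ⊢⊥E {φ} = taut (ax-⊥E p) (valuation φ φ φ)

  infixl 6 _⨾_

  ⊢-const : ∀ {φ ψ} → ⊢ ψ → ⊢ φ ⇒ ψ
  ⊢-const = MP ⊢K

  ⊢-ap : ∀ {χ φ ψ} → ⊢ χ ⇒ φ ⇒ ψ → ⊢ χ ⇒ φ → ⊢ χ ⇒ ψ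
  ⊢-ap f g = MP (MP ⊢S f) g

  ⊢-id : ∀ {φ} → ⊢ φ ⇒ φ
  ⊢-id {φ} = ⊢-ap (⊢K {φ} {φ ⇒ φ}) ⊢K

  _⨾_ : ∀ {φ ψ χ} → ⊢ φ ⇒ ψ → ⊢ ψ ⇒ χ → ⊢ φ ⇒ χ
  f ⨾ g = ⊢-ap (⊢-const g) f

  ⊢-post : ∀ {φ ψ χ} → ⊢ φ ⇒ ψ → ⊢ (χ ⇒ φ) ⇒ (χ ⇒ ψ)
  ⊢-post f = MP ⊢S (⊢-const f)

  ⊢-pair : ∀ {χ φ ψ} → ⊢ χ ⇒ φ → ⊢ χ ⇒ ψ → ⊢ χ ⇒ φ ∧' ψ
  ⊢-pair f g = ⊢-ap (f ⨾ ⊢∧I) g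

  ⊢-curry : ∀ {φ ψ χ} → ⊢ φ ∧' ψ ⇒ χ → ⊢ φ ⇒ ψ ⇒ χ
  ⊢-curry f = ⊢∧I ⨾ ⊢-post f

  ⊢-uncurry : ∀ {φ ψ χ} → ⊢ φ ⇒ ψ ⇒ χ → ⊢ φ ∧' ψ ⇒ χ
  ⊢-uncurry f = ⊢-ap (⊢∧E₁ ⨾ f) ⊢∧E₂

  ⊢-flip : ∀ {φ ψ χ} → ⊢ φ ⇒ ψ ⇒ χ → ⊢ ψ ⇒ φ ⇒ χ
  ⊢-flip f = ⊢-curry (⊢-pair ⊢∧E₂ ⊢∧E₁ ⨾ ⊢-uncurry f)

  ⊢-case : ∀ {φ ψ χ} → ⊢ φ ⇒ χ → ⊢ ψ ⇒ χ → ⊢ φ ∨' ψ ⇒ χ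
  ⊢-case f g = MP (MP ⊢∨E f) g

  ⊢∨-mapˡ : ∀ {φ ψ χ} → ⊢ (φ ⇒ ψ) ⇒ φ ∨' χ ⇒ ψ ∨' χ
  ⊢∨-mapˡ = ⊢-ap (⊢-ap (⊢-const ⊢∨E) (⊢-post ⊢∨I₁)) (⊢-const ⊢∨I₂)

  ⋀-++ : ∀ φs ψs → ⊢ ⋀ (φs ++ ψs) ⇒ ⋀ φs ∧' ⋀ ψs
  ⋀-++ []       ψs = ⊢-pair (⊢-const ⊢-id) ⊢-id
  ⋀-++ (φ ∷ φs) ψs = ⊢-pair (⊢-pair ⊢∧E₁ (rest ⨾ ⊢∧E₁)) (rest ⨾ ⊢∧E₂)
    where
      rest : ⊢ ⋀ (φ ∷ φs ++ ψs) ⇒ ⋀ φs ∧' ⋀ ψs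
      rest = ⊢∧E₂ ⨾ ⋀-++ φs ψs

  ⋁-++ : ∀ φs ψs → ⊢ ⋁ φs ∨' ⋁ ψs ⇒ ⋁ (φs ++ ψs)
  ⋁-++ []       ψs = ⊢-case ⊢⊥E ⊢-id
  ⋁-++ (φ ∷ φs) ψs = ⊢-case (⊢-case ⊢∨I₁ (⊢∨I₁ ⨾ rest ⨾ ⊢∨I₂)) (⊢∨I₂ ⨾ rest ⨾ ⊢∨I₂)
    where
      rest : ⊢ ⋁ φs ∨' ⋁ ψs ⇒ ⋁ (φs ++ ψs)
      rest = ⋁-++ φs ψs

module Substitution (σ : Signature) where
  open Signature σ
  open Syntax σ

  LeftInverse : ∀ {n m} → Subst n m → Subst m n → Set
  LeftInverse s s′ = ∀ i → substT s′ (s i) ≡ var i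

  substT-liftS-renT : ∀ {n m} (s : Subst m n) (t : Term m) →
                      substT (liftS s) (renT Fin.suc t) ≡ renT Fin.suc (substT s t)
  substT-liftS-renT s (var i)   = refl
  substT-liftS-renT s (const c) = refl

  liftS-leftInverse : ∀ {n m} {s : Subst n m} {s′ : Subst m n} →
                      LeftInverse s s′ → LeftInverse (liftS s) (liftS s′)
  liftS-leftInverse inv zero = refl
  liftS-leftInverse {s = s} {s′} inv (suc i) =
    trans (substT-liftS-renT s′ (s i)) (cong (renT Fin.suc) (inv i))

  module _ {n m} {s : Subst n m} {s′ : Subst m n} (inv : LeftInverse s s′) where
    substT-inverse : ∀ t → substT s′ (substT s t) ≡ t
    substT-inverse (var i)   = inv i
    substT-inverse (const c) = refl

    substTs-inverse : ∀ {k} (ts : Vec (Term n) k) → substTs s′ (substTs s ts) ≡ ts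
    substTs-inverse []       = refl
    substTs-inverse (t ∷ ts) = cong₂ _∷_ (substT-inverse t) (substTs-inverse ts)

  subst-inverse : ∀ {n m} {s : Subst n m} {s′ : Subst m n} →
                  LeftInverse s s′ → ∀ φ → subst s′ (subst s φ) ≡ φ
  subst-inverse inv (atom p ts) = cong (atom p) (substTs-inverse inv ts)
  subst-inverse inv (t ≐ u)     = cong₂ _≐_ (substT-inverse inv t) (substT-inverse inv u)
  subst-inverse inv ⊥'          = refl
  subst-inverse inv (φ ∧' ψ)    = cong₂ _∧'_ (subst-inverse inv φ) (subst-inverse inv ψ)
  subst-inverse inv (φ ∨' ψ)    = cong₂ _∨'_ (subst-inverse inv φ) (subst-inverse inv ψ)
  subst-inverse inv (φ ⇒ ψ)     = cong₂ _⇒_ (subst-inverse inv φ) (subst-inverse inv ψ)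
  subst-inverse inv (□ φ)       = cong □ (subst-inverse inv φ)
  subst-inverse inv (◇ φ)       = cong ◇ (subst-inverse inv φ)
  subst-inverse inv (∀' φ)      = cong ∀' (subst-inverse (liftS-leftInverse inv) φ)
  subst-inverse inv (∃' φ)      = cong ∃' (subst-inverse (liftS-leftInverse inv) φ)

  instantiate-wk : ∀ χ c → wk χ [ c ] ≡ χ
  instantiate-wk χ c = subst-inverse (λ ()) χ

  Avoids : ∀ {n m} → Const → Subst n m → Set
  Avoids c s = ∀ i → ¬ OccursT c (s i)

  renT-avoids : ∀ {n} c (t : Term n) → ¬ OccursT c t → ¬ OccursT c (renT {m = suc n} Fin.suc t)
  renT-avoids c (const .c) c∉t here = c∉t here

  liftS-avoids : ∀ {n m c} {s : Subst n m} → Avoids c s → Avoids c (liftS s)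
  liftS-avoids c∉s zero ()
  liftS-avoids {s = s} c∉s (suc i) = renT-avoids _ (s i) (c∉s i)

  module _ {n m c} {s : Subst n m} (c∉s : Avoids c s) where
    occursT-substT : ∀ t → OccursT c (substT s t) → OccursT c t
    occursT-substT (var i)    o    = ⊥-elim (c∉s i o)
    occursT-substT (const .c) here = here

    occursTs-substTs : ∀ {k} (ts : Vec (Term n) k) →
                       VAny.Any (OccursT c) (substTs s ts) → VAny.Any (OccursT c) ts
    occursTs-substTs (t ∷ ts) (VAny.here o)  = VAny.here (occursT-substT t o)
    occursTs-substTs (t ∷ ts) (VAny.there o) = VAny.there (occursTs-substTs ts o)

  occurs-subst : ∀ {n m c} {s : Subst n m} → Avoids c s → ∀ φ → Occurs c (subst s φ) → Occurs c φ
  occurs-subst c∉s (atom p ts) (inAtom o) = inAtom (occursTs-substTs c∉s ts o)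
  occurs-subst c∉s (t ≐ u)     (inEqˡ o)  = inEqˡ (occursT-substT c∉s t o)
  occurs-subst c∉s (t ≐ u)     (inEqʳ o)  = inEqʳ (occursT-substT c∉s u o)
  occurs-subst c∉s (φ ∧' ψ)    (∧ˡ o)     = ∧ˡ (occurs-subst c∉s φ o)
  occurs-subst c∉s (φ ∧' ψ)    (∧ʳ o)     = ∧ʳ (occurs-subst c∉s ψ o)
  occurs-subst c∉s (φ ∨' ψ)    (∨ˡ o)     = ∨ˡ (occurs-subst c∉s φ o)
  occurs-subst c∉s (φ ∨' ψ)    (∨ʳ o)     = ∨ʳ (occurs-subst c∉s ψ o)
  occurs-subst c∉s (φ ⇒ ψ)     (⇒ˡ o)     = ⇒ˡ (occurs-subst c∉s φ o)
  occurs-subst c∉s (φ ⇒ ψ)     (⇒ʳ o)     = ⇒ʳ (occurs-subst c∉s ψ o)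
  occurs-subst c∉s (□ φ)       (in□ o)    = in□ (occurs-subst c∉s φ o)
  occurs-subst c∉s (◇ φ)       (in◇ o)    = in◇ (occurs-subst c∉s φ o)
  occurs-subst c∉s (∀' φ)      (in∀ o)    = in∀ (occurs-subst (liftS-avoids c∉s) φ o)
  occurs-subst c∉s (∃' φ)      (in∃ o)    = in∃ (occurs-subst (liftS-avoids c∉s) φ o)

  occurs-wk : ∀ {c} χ → Occurs c (wk χ) → Occurs c χ
  occurs-wk = occurs-subst (λ ())

module Encoding (σ : Signature) where
  open Signature σ
  open Syntax σ

  private
    constCode : Const → ℕ
    constCode = Inverse.to constCount

    predCode : PredSym → ℕ
    predCode = Injection.to predCount

  treeᵗ : ∀ {n} → Term n → Tree
  treeᵗ (var i)   = node (leaf 0) (leaf (toℕ i))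
  treeᵗ (const c) = node (leaf 1) (leaf (constCode c))

  treeᵗˢ : ∀ {n k} → Vec (Term n) k → Tree
  treeᵗˢ []       = leaf 0
  treeᵗˢ (t ∷ ts) = node (treeᵗ t) (treeᵗˢ ts)

  tree : ∀ {n} → Formula n → Tree
  tree (atom p ts) = node (leaf 0) (node (leaf (predCode p)) (treeᵗˢ ts))
  tree (t ≐ u)     = node (leaf 1) (node (treeᵗ t) (treeᵗ u))
  tree ⊥'          = node (leaf 2) (leaf 0)
  tree (φ ∧' ψ)    = node (leaf 3) (node (tree φ) (tree ψ))
  tree (φ ∨' ψ)    = node (leaf 4) (node (tree φ) (tree ψ))
  tree (φ ⇒ ψ)     = node (leaf 5) (node (tree φ) (tree ψ))
  tree (□ φ)       = node (leaf 6) (tree φ)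
  tree (◇ φ)       = node (leaf 7) (tree φ)
  tree (∀' φ)      = node (leaf 8) (tree φ)
  tree (∃' φ)      = node (leaf 9) (tree φ)

  -- The graphs of the tree functions as inductive families: all their tree
  -- indices are constructor patterns, so in a proof of functionality Agda's
  -- unifier itself discards every pair of mismatched constructors.
  data Encodesᵗ {n} : Term n → Tree → Set where
    var   : ∀ {i k} → toℕ i ≡ k → Encodesᵗ (var i) (node (leaf 0) (leaf k))
    const : ∀ {c k} → constCode c ≡ k → Encodesᵗ (const c) (node (leaf 1) (leaf k))

  data Encodesᵗˢ {n} : ∀ {k} → Vec (Term n) k → Tree → Set where
    []  : Encodesᵗˢ [] (leaf 0)
    _∷_ : ∀ {k t s} {ts : Vec (Term n) k} {r} →
          Encodesᵗ t s → Encodesᵗˢ ts r → Encodesᵗˢ (t ∷ ts) (node s r)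

  data Encodes {n} : Formula n → Tree → Set where
    atom : ∀ {p k ts r} → predCode p ≡ k → Encodesᵗˢ ts r →
           Encodes (atom p ts) (node (leaf 0) (node (leaf k) r))
    _≐_  : ∀ {t u s r} → Encodesᵗ t s → Encodesᵗ u r → Encodes (t ≐ u) (node (leaf 1) (node s r))
    ⊥'   : Encodes ⊥' (node (leaf 2) (leaf 0))
    _∧'_ : ∀ {φ ψ s r} → Encodes φ s → Encodes ψ r → Encodes (φ ∧' ψ) (node (leaf 3) (node s r))
    _∨'_ : ∀ {φ ψ s r} → Encodes φ s → Encodes ψ r → Encodes (φ ∨' ψ) (node (leaf 4) (node s r))
    _⇒_  : ∀ {φ ψ s r} → Encodes φ s → Encodes ψ r → Encodes (φ ⇒ ψ) (node (leaf 5) (node s r))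
    □    : ∀ {φ s} → Encodes φ s → Encodes (□ φ) (node (leaf 6) s)
    ◇    : ∀ {φ s} → Encodes φ s → Encodes (◇ φ) (node (leaf 7) s)
    ∀'   : ∀ {φ s} → Encodes {suc n} φ s → Encodes (∀' φ) (node (leaf 8) s)
    ∃'   : ∀ {φ s} → Encodes {suc n} φ s → Encodes (∃' φ) (node (leaf 9) s)

  encodesᵗ : ∀ {n} (t : Term n) → Encodesᵗ t (treeᵗ t)
  encodesᵗ (var i)   = var refl
  encodesᵗ (const c) = const refl

  encodesᵗˢ : ∀ {n k} (ts : Vec (Term n) k) → Encodesᵗˢ ts (treeᵗˢ ts)
  encodesᵗˢ []       = []
  encodesᵗˢ (t ∷ ts) = encodesᵗ t ∷ encodesᵗˢ ts

  encodes : ∀ {n} (φ : Formula n) → Encodes φ (tree φ)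
  encodes (atom p ts) = atom refl (encodesᵗˢ ts)
  encodes (t ≐ u)     = encodesᵗ t ≐ encodesᵗ u
  encodes ⊥'          = ⊥'
  encodes (φ ∧' ψ)    = encodes φ ∧' encodes ψ
  encodes (φ ∨' ψ)    = encodes φ ∨' encodes ψ
  encodes (φ ⇒ ψ)     = encodes φ ⇒ encodes ψ
  encodes (□ φ)       = □ (encodes φ)
  encodes (◇ φ)       = ◇ (encodes φ)
  encodes (∀' φ)      = ∀' (encodes φ)
  encodes (∃' φ)      = ∃' (encodes φ)

  encodesᵗ-functional : ∀ {n} {t u : Term n} {s} → Encodesᵗ t s → Encodesᵗ u s → t ≡ u
  encodesᵗ-functional (var refl)   (var e)   = cong var (sym (toℕ-injective e))
  encodesᵗ-functional (const refl) (const e) =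
    cong const (sym (Injection.injective (↔⇒↣ constCount) e))

  encodesᵗˢ-functional : ∀ {n k} {ts us : Vec (Term n) k} {s} →
                         Encodesᵗˢ ts s → Encodesᵗˢ us s → ts ≡ us
  encodesᵗˢ-functional []       []         = refl
  encodesᵗˢ-functional (d ∷ ds) (d′ ∷ ds′) =
    cong₂ _∷_ (encodesᵗ-functional d d′) (encodesᵗˢ-functional ds ds′)

  encodes-functional : ∀ {n} {φ ψ : Formula n} {s} → Encodes φ s → Encodes ψ s → φ ≡ ψ
  encodes-functional (atom refl ds) (atom e ds′) with Injection.injective predCount e
  ... | refl = cong (atom _) (encodesᵗˢ-functional ds ds′)
  encodes-functional (d₁ ≐ d₂) (d₁′ ≐ d₂′) =
    cong₂ _≐_ (encodesᵗ-functional d₁ d₁′) (encodesᵗ-functional d₂ d₂′)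
  encodes-functional ⊥' ⊥' = refl
  encodes-functional (d₁ ∧' d₂) (d₁′ ∧' d₂′) =
    cong₂ _∧'_ (encodes-functional d₁ d₁′) (encodes-functional d₂ d₂′)
  encodes-functional (d₁ ∨' d₂) (d₁′ ∨' d₂′) =
    cong₂ _∨'_ (encodes-functional d₁ d₁′) (encodes-functional d₂ d₂′)
  encodes-functional (d₁ ⇒ d₂) (d₁′ ⇒ d₂′) =
    cong₂ _⇒_ (encodes-functional d₁ d₁′) (encodes-functional d₂ d₂′)
  encodes-functional (□ d)  (□ d′)  = cong □ (encodes-functional d d′)
  encodes-functional (◇ d)  (◇ d′)  = cong ◇ (encodes-functional d d′)
  encodes-functional (∀' d) (∀' d′) = cong ∀' (encodes-functional d d′)
  encodes-functional (∃' d) (∃' d′) = cong ∃' (encodes-functional d d′)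

  tree-injective : ∀ {n} {φ ψ : Formula n} → tree φ ≡ tree ψ → φ ≡ ψ
  tree-injective {φ = φ} {ψ} e = encodes-functional (transport (Encodes φ) e (encodes φ)) (encodes ψ)

  code : Sentence → ℕ
  code = treeCode ∘ tree

  code-injective : ∀ {φ ψ} → code φ ≡ code ψ → φ ≡ ψ
  code-injective = tree-injective ∘ treeCode-injective

module FreshConstants (em : ExcludedMiddle 0ℓ) (σ : Signature) (fresh : ℕ ↣ Signature.Const σ) where
  open Signature σ
  open Syntax σ
  open Eventually em fresh
  open Injection fresh using (to)

  occursᵗ-avoided : ∀ {n} (t : Term n) → EventuallyAvoided (λ c → OccursT c t)
  occursᵗ-avoided (var i)   = avoided-⊆ (λ ()) avoided-∅
  occursᵗ-avoided (const d) = avoided-⊆ (λ { here → refl }) (avoided-≡ d)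

  occursᵗˢ-avoided : ∀ {n k} (ts : Vec (Term n) k) → EventuallyAvoided (λ c → VAny.Any (OccursT c) ts)
  occursᵗˢ-avoided []       = avoided-⊆ (λ ()) avoided-∅
  occursᵗˢ-avoided (t ∷ ts) = avoided-⊆ VAny.toSum (avoided-∪ (occursᵗ-avoided t) (occursᵗˢ-avoided ts))

  occurs-avoided : ∀ {n} (φ : Formula n) → EventuallyAvoided (λ c → Occurs c φ)
  occurs-avoided (atom p ts) = avoided-⊆ (λ { (inAtom o) → o }) (occursᵗˢ-avoided ts)
  occurs-avoided (t ≐ u) =
    avoided-⊆ (λ { (inEqˡ o) → inj₁ o ; (inEqʳ o) → inj₂ o }) (avoided-∪ (occursᵗ-avoided t) (occursᵗ-avoided u))
  occurs-avoided ⊥' = avoided-⊆ (λ ()) avoided-∅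
  occurs-avoided (φ ∧' ψ) =
    avoided-⊆ (λ { (∧ˡ o) → inj₁ o ; (∧ʳ o) → inj₂ o }) (avoided-∪ (occurs-avoided φ) (occurs-avoided ψ))
  occurs-avoided (φ ∨' ψ) =
    avoided-⊆ (λ { (∨ˡ o) → inj₁ o ; (∨ʳ o) → inj₂ o }) (avoided-∪ (occurs-avoided φ) (occurs-avoided ψ))
  occurs-avoided (φ ⇒ ψ) =
    avoided-⊆ (λ { (⇒ˡ o) → inj₁ o ; (⇒ʳ o) → inj₂ o }) (avoided-∪ (occurs-avoided φ) (occurs-avoided ψ))
  occurs-avoided (□ φ)  = avoided-⊆ (λ { (in□ o) → o }) (occurs-avoided φ)
  occurs-avoided (◇ φ)  = avoided-⊆ (λ { (in◇ o) → o }) (occurs-avoided φ)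
  occurs-avoided (∀' φ) = avoided-⊆ (λ { (in∀ o) → o }) (occurs-avoided φ)
  occurs-avoided (∃' φ) = avoided-⊆ (λ { (in∃ o) → o }) (occurs-avoided φ)

  any-occurs-avoided : ∀ (φs : List Sentence) → EventuallyAvoided (λ c → Any (Occurs c) φs)
  any-occurs-avoided []       = avoided-⊆ (λ ()) avoided-∅
  any-occurs-avoided (φ ∷ φs) = avoided-⊆ Any.toSum (avoided-∪ (occurs-avoided φ) (any-occurs-avoided φs))

  freshIndex : List Sentence → ℕ
  freshIndex φs = EventuallyAvoided.bound (any-occurs-avoided φs)

  freshIndex-fresh : ∀ φs → All (λ φ → ¬ Occurs (to (freshIndex φs)) φ) φs
  freshIndex-fresh φs = ¬Any⇒All¬ φs (EventuallyAvoided.avoids (any-occurs-avoided φs) _ ≤-refl)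

module Theories (σ : Signature) where
  open FOFS σ
  open Hilbert σ
  open Substitution σ

  infixr 5 _∷ˢ_ _++ˢ_

  _∷ˢ_ : Sentence → Sentences → Sentences
  (ψ ∷ˢ Δ) φ = φ ≡ ψ ⊎ Δ φ

  _++ˢ_ : List Sentence → Sentences → Sentences
  []       ++ˢ Δ = Δ
  (ψ ∷ ψs) ++ˢ Δ = ψ ∷ˢ (ψs ++ˢ Δ)

  Inconsistent : Sentences → Sentences → Set
  Inconsistent Δ Θ = Σ (List Sentence) λ ωs → All Θ ωs × (Δ ⊢ ⋁ ωs)

  Exhaustive : Sentences → Sentences → Set
  Exhaustive Δ Θ = ∀ φ → Δ φ ⊎ Θ φ

  module _ {Δ : Sentences} where
    assumption : ∀ {φ} → Δ φ → Δ ⊢ φ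
    assumption {φ} φ∈Δ = φ ∷ [] , φ∈Δ ∷ [] , ⊢∧E₁

    assumptions : ∀ {γs} → All Δ γs → Δ ⊢ ⋀ γs
    assumptions {γs} γs⊆Δ = γs , γs⊆Δ , ⊢-id

    ⊢ˢ-map : ∀ {φ ψ} → ⊢ φ ⇒ ψ → Δ ⊢ φ → Δ ⊢ ψ
    ⊢ˢ-map f (γs , γs⊆Δ , d) = γs , γs⊆Δ , d ⨾ f

    ⊢ˢ-mp : ∀ {φ ψ} → Δ ⊢ (φ ⇒ ψ) → Δ ⊢ φ → Δ ⊢ ψ
    ⊢ˢ-mp (γs , γs⊆Δ , d) (γs′ , γs′⊆Δ , d′) =
      γs ++ γs′ , ++⁺ γs⊆Δ γs′⊆Δ , ⋀-++ γs γs′ ⨾ ⊢-ap (⊢∧E₁ ⨾ d) (⊢∧E₂ ⨾ d′)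

  split-⋀ : ∀ {ψ Δ} γs → All (ψ ∷ˢ Δ) γs → ∃ λ γs₀ → All Δ γs₀ × (⊢ ⋀ γs₀ ∧' ψ ⇒ ⋀ γs)
  split-⋀ []       []              = [] , [] , ⊢-const ⊢-id
  split-⋀ (γ ∷ γs) (inj₁ refl ∷ a) with split-⋀ γs a
  ... | γs₀ , a₀ , d = γs₀ , a₀ , ⊢-pair ⊢∧E₂ d
  split-⋀ (γ ∷ γs) (inj₂ γ∈Δ ∷ a) with split-⋀ γs a
  ... | γs₀ , a₀ , d = γ ∷ γs₀ , γ∈Δ ∷ a₀ ,
                       ⊢-pair (⊢∧E₁ ⨾ ⊢∧E₁) (⊢-pair (⊢∧E₁ ⨾ ⊢∧E₂) ⊢∧E₂ ⨾ d)

  split-⋁ : ∀ {ψ Θ} ωs → All (ψ ∷ˢ Θ) ωs → ∃ λ ωs₀ → All Θ ωs₀ × (⊢ ⋁ ωs ⇒ ψ ∨' ⋁ ωs₀)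
  split-⋁ []       []              = [] , [] , ⊢⊥E
  split-⋁ (ω ∷ ωs) (inj₁ refl ∷ a) with split-⋁ ωs a
  ... | ωs₀ , a₀ , d = ωs₀ , a₀ , ⊢-case ⊢∨I₁ d
  split-⋁ (ω ∷ ωs) (inj₂ ω∈Θ ∷ a) with split-⋁ ωs a
  ... | ωs₀ , a₀ , d = ω ∷ ωs₀ , ω∈Θ ∷ a₀ ,
                       ⊢-case (⊢∨I₁ ⨾ ⊢∨I₂) (d ⨾ ⊢-case ⊢∨I₁ (⊢∨I₂ ⨾ ⊢∨I₂))

  deduction : ∀ {Δ ψ χ} → (ψ ∷ˢ Δ) ⊢ χ → Δ ⊢ (ψ ⇒ χ)
  deduction (γs , γs⊆ψΔ , d) with split-⋀ γs γs⊆ψΔ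
  ... | γs₀ , γs₀⊆Δ , e = γs₀ , γs₀⊆Δ , ⊢-curry (e ⨾ d)

  -- If Δ, ψ ⊢ ⋁ ωs and Δ ⊢ ψ ∨ ⋁ ωs′ then Δ ⊢ ⋁ (ωs ++ ωs′).
  consistent-reject : ∀ {Δ Θ ψ} → ConsistentPair Δ Θ → Inconsistent (ψ ∷ˢ Δ) Θ →
                      ConsistentPair Δ (ψ ∷ˢ Θ)
  consistent-reject con (ωs , ωs⊆Θ , d) (ωs′ , ωs′⊆ψΘ , d′) with split-⋁ ωs′ ωs′⊆ψΘ
  ... | ωs₀ , ωs₀⊆Θ , e =
    con (ωs ++ ωs₀ , ++⁺ ωs⊆Θ ωs₀⊆Θ ,
         ⊢ˢ-map (⋁-++ ωs ωs₀) (⊢ˢ-mp (⊢ˢ-map ⊢∨-mapˡ (deduction d)) (⊢ˢ-map e d′)))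

  fresh-++ˢ : ∀ {c Δ φs} → All (λ φ → ¬ Occurs c φ) φs → FreshFor c Δ → FreshFor c (φs ++ˢ Δ)
  fresh-++ˢ []           c∉Δ φ φ∈Δ           = c∉Δ φ φ∈Δ
  fresh-++ˢ (c∉ψ ∷ _)    c∉Δ φ (inj₁ refl)   = c∉ψ
  fresh-++ˢ (_ ∷ c∉ψs)   c∉Δ φ (inj₂ φ∈ψsΔ) = fresh-++ˢ c∉ψs c∉Δ φ φ∈ψsΔ

  fresh-⋀ : ∀ {c Δ γs} → FreshFor c Δ → All Δ γs → ¬ Occurs c (⋀ γs)
  fresh-⋀ c∉Δ []           (⇒ˡ ())
  fresh-⋀ c∉Δ []           (⇒ʳ ())
  fresh-⋀ c∉Δ (γ∈Δ ∷ _)    (∧ˡ o) = c∉Δ _ γ∈Δ o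
  fresh-⋀ c∉Δ (_ ∷ γs⊆Δ)   (∧ʳ o) = fresh-⋀ c∉Δ γs⊆Δ o

  fresh-⋁ : ∀ {c Θ ωs} → FreshFor c Θ → All Θ ωs → ¬ Occurs c (⋁ ωs)
  fresh-⋁ c∉Θ (ω∈Θ ∷ _)  (∨ˡ o) = c∉Θ _ ω∈Θ o
  fresh-⋁ c∉Θ (_ ∷ ωs⊆Θ) (∨ʳ o) = fresh-⋁ c∉Θ ωs⊆Θ o

  ∃-elim-fresh : ∀ {φ χ c} → ¬ Occurs c φ → ¬ Occurs c χ → ⊢ φ [ c ] ⇒ χ → ⊢ ∃' φ ⇒ χ
  ∃-elim-fresh {φ} {χ} {c} c∉φ c∉χ d =
    MP (∃E φ χ) (Gen (φ ⇒ wk χ) c c∉φ⇒χ (transport (λ θ → ⊢ φ [ c ] ⇒ θ) (sym (instantiate-wk χ c)) d))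
    where
      c∉φ⇒χ : ¬ Occurs c (φ ⇒ wk χ)
      c∉φ⇒χ (⇒ˡ o) = c∉φ o
      c∉φ⇒χ (⇒ʳ o) = c∉χ (occurs-wk χ o)

  consistent-witness : ∀ {Δ Θ φ c} → FreshFor c (∃' φ ∷ˢ Δ) → FreshFor c Θ →
                       ConsistentPair (∃' φ ∷ˢ Δ) Θ → ConsistentPair (φ [ c ] ∷ˢ ∃' φ ∷ˢ Δ) Θ
  consistent-witness {φ = φ} {c} c∉Δ c∉Θ con (ωs , ωs⊆Θ , d) with deduction d
  ... | γs , γs⊆Δ , h =
    con (ωs , ωs⊆Θ , ⊢ˢ-mp (⊢ˢ-map ∃φ⇒χ (assumption (inj₁ refl))) (assumptions γs⊆Δ))
    where
      c∉χ : ¬ Occurs c (⋀ γs ⇒ ⋁ ωs)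
      c∉χ (⇒ˡ o) = fresh-⋀ c∉Δ γs⊆Δ o
      c∉χ (⇒ʳ o) = fresh-⋁ c∉Θ ωs⊆Θ o

      ∃φ⇒χ : ⊢ ∃' φ ⇒ ⋀ γs ⇒ ⋁ ωs
      ∃φ⇒χ = ∃-elim-fresh (λ o → c∉Δ (∃' φ) (inj₁ refl) (in∃ o)) c∉χ (⊢-flip h)

  module _ {Δ Θ} (con : ConsistentPair Δ Θ) where
    consistent-¬⊢⊥ : ¬ (Δ ⊢ ⊥')
    consistent-¬⊢⊥ d = con ([] , [] , d)

    consistent-disjoint : ∀ {φ} → Δ φ → Θ φ → ⊥
    consistent-disjoint {φ} φ∈Δ φ∈Θ = con (φ ∷ [] , φ∈Θ ∷ [] , ⊢ˢ-map ⊢∨I₁ (assumption φ∈Δ))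

    exhaustive⇒closed : Exhaustive Δ Θ → ∀ {φ} → Δ ⊢ φ → Δ φ
    exhaustive⇒closed ex {φ} d with ex φ
    ... | inj₁ φ∈Δ = φ∈Δ
    ... | inj₂ φ∈Θ = ⊥-elim (con (φ ∷ [] , φ∈Θ ∷ [] , ⊢ˢ-map ⊢∨I₁ d))

    exhaustive⇒prime : Exhaustive Δ Θ → ∀ {φ ψ} → Δ (φ ∨' ψ) → Δ φ ⊎ Δ ψ
    exhaustive⇒prime ex {φ} {ψ} φ∨ψ∈Δ with ex φ | ex ψ
    ... | inj₁ φ∈Δ | _        = inj₁ φ∈Δ
    ... | inj₂ _   | inj₁ ψ∈Δ = inj₂ ψ∈Δ
    ... | inj₂ φ∈Θ | inj₂ ψ∈Θ = ⊥-elim (con (φ ∷ ψ ∷ [] , φ∈Θ ∷ ψ∈Θ ∷ [] ,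
                                  ⊢ˢ-map (⊢-case ⊢∨I₁ (⊢∨I₁ ⨾ ⊢∨I₂)) (assumption φ∨ψ∈Δ)))

module Lindenbaum (em : ExcludedMiddle 0ℓ) (σ : Signature) (Γ Ω : FOFS.Sentences σ)
                  (con : FOFS.ConsistentPair σ Γ Ω) (fresh : ℕ ↣ Signature.Const σ)
                  (fresh-new : ∀ n → FOFS.FreshFor σ (Injection.to fresh n) (λ φ → Γ φ ⊎ Ω φ))
                  where
  open FOFS σ
  open Theories σ
  open Encoding σ using (code; code-injective)
  open Enumeration em ⊥' code code-injective
  open FreshConstants em σ fresh
  open Injection fresh using (to)

  record Stage : Set where
    constructor _∣_
    field
      accepted rejected : List Sentence
  open Stage

  Γ⁺ Ω⁺ : Stage → Sentences
  Γ⁺ s = accepted s ++ˢ Γ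
  Ω⁺ s = rejected s ++ˢ Ω

  -- other may also classify an existential; no proof needs to rule that out.
  data ExistsView : Sentence → Set where
    ∃-form : ∀ φ → ExistsView (∃' φ)
    other  : ∀ {ψ} → ExistsView ψ

  existsView : ∀ ψ → ExistsView ψ
  existsView (∃' φ) = ∃-form φ
  existsView ψ      = other

  accept : ∀ {ψ} → ExistsView ψ → Stage → List Sentence
  accept (∃-form φ) (A ∣ B) = φ [ to (freshIndex (∃' φ ∷ A ++ B)) ] ∷ ∃' φ ∷ A
  accept {ψ} other  (A ∣ B) = ψ ∷ A

  step : ∀ ψ s → Dec (Inconsistent (ψ ∷ˢ Γ⁺ s) (Ω⁺ s)) → Stage
  step ψ s (yes _) = accepted s ∣ (ψ ∷ rejected s)
  step ψ s (no _)  = accept (existsView ψ) s ∣ rejected s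

  stage : ℕ → Stage
  stage zero    = [] ∣ []
  stage (suc n) = step (decode n) (stage n) em

  Γₙ Ωₙ : ℕ → Sentences
  Γₙ = Γ⁺ ∘ stage
  Ωₙ = Ω⁺ ∘ stage

  accept-consistent : ∀ {ψ} (v : ExistsView ψ) s → ConsistentPair (ψ ∷ˢ Γ⁺ s) (Ω⁺ s) →
                      ConsistentPair (accept v s ++ˢ Γ) (Ω⁺ s)
  accept-consistent (∃-form φ) (A ∣ B) =
    consistent-witness (fresh-++ˢ (++⁻ˡ (∃' φ ∷ A) new) (λ ψ ψ∈Γ → fresh-new N ψ (inj₁ ψ∈Γ)))
                       (fresh-++ˢ (++⁻ʳ (∃' φ ∷ A) new) (λ ψ ψ∈Ω → fresh-new N ψ (inj₂ ψ∈Ω)))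
    where
      N : ℕ
      N = freshIndex (∃' φ ∷ A ++ B)

      new : All (λ ψ → ¬ Occurs (to N) ψ) (∃' φ ∷ A ++ B)
      new = freshIndex-fresh (∃' φ ∷ A ++ B)
  accept-consistent other s = id

  step-consistent : ∀ ψ s d → ConsistentPair (Γ⁺ s) (Ω⁺ s) →
                    ConsistentPair (Γ⁺ (step ψ s d)) (Ω⁺ (step ψ s d))
  step-consistent ψ s (yes inc) con′ = consistent-reject con′ inc
  step-consistent ψ s (no ¬inc) _    = accept-consistent (existsView ψ) s ¬inc

  stage-consistent : ∀ n → ConsistentPair (Γₙ n) (Ωₙ n)
  stage-consistent zero    = con
  stage-consistent (suc n) = step-consistent (decode n) (stage n) em (stage-consistent n)

  accept-grows : ∀ {ψ} (v : ExistsView ψ) s → Γ⁺ s ⊆ (accept v s ++ˢ Γ)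
  accept-grows (∃-form φ) s = inj₂ ∘ inj₂
  accept-grows other      s = inj₂

  step-growsˡ : ∀ ψ s d → Γ⁺ s ⊆ Γ⁺ (step ψ s d)
  step-growsˡ ψ s (yes _) = id
  step-growsˡ ψ s (no _)  = accept-grows (existsView ψ) s

  step-growsʳ : ∀ ψ s d → Ω⁺ s ⊆ Ω⁺ (step ψ s d)
  step-growsʳ ψ s (yes _) = inj₂
  step-growsʳ ψ s (no _)  = id

  module Γ-chain = Chain Γₙ (λ n → step-growsˡ (decode n) (stage n) em)
  module Ω-chain = Chain Ωₙ (λ n → step-growsʳ (decode n) (stage n) em)

  Γ' Ω' : Sentences
  Γ' = Γ-chain.⋃S
  Ω' = Ω-chain.⋃S

  limit-consistent : ConsistentPair Γ' Ω'
  limit-consistent (ωs , ωs⊆Ω' , γs , γs⊆Γ' , d)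
    with Γ-chain.all-in-some-stage γs⊆Γ' | Ω-chain.all-in-some-stage ωs⊆Ω'
  ... | m , γs⊆Γₘ | n , ωs⊆Ωₙ =
    stage-consistent (m ⊔ n) (ωs , All.map (Ω-chain.mono (m≤n⊔m m n)) ωs⊆Ωₙ ,
                              γs , All.map (Γ-chain.mono (m≤m⊔n m n)) γs⊆Γₘ , d)

  step-decides : ∀ {ψ φ} → ψ ≡ φ → ∀ s d → Γ⁺ (step ψ s d) φ ⊎ Ω⁺ (step ψ s d) φ
  step-decides refl s (yes _) = inj₂ (inj₁ refl)
  step-decides {ψ} refl s (no _) with existsView ψ
  ... | ∃-form φ = inj₁ (inj₂ (inj₁ refl))
  ... | other    = inj₁ (inj₁ refl)

  limit-exhaustive : Exhaustive Γ' Ω'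
  limit-exhaustive φ with step-decides (decode-code φ) (stage (code φ)) em
  ... | inj₁ φ∈Γₙ = inj₁ (suc (code φ) , φ∈Γₙ)
  ... | inj₂ φ∈Ωₙ = inj₂ (suc (code φ) , φ∈Ωₙ)

  step-witnesses : ∀ {ψ φ} → ψ ≡ ∃' φ → ∀ s d →
                   Ω⁺ (step ψ s d) (∃' φ) ⊎ ∃ λ c → Γ⁺ (step ψ s d) (φ [ c ])
  step-witnesses refl s (yes _) = inj₁ (inj₁ refl)
  step-witnesses refl s (no _)  = inj₂ (_ , inj₁ refl)

  limit-witnessed : ∀ φ → Γ' (∃' φ) → ∃ λ c → Γ' (φ [ c ])
  limit-witnessed φ ∃φ∈Γ' with step-witnesses (decode-code (∃' φ)) (stage (code (∃' φ))) em
  ... | inj₁ ∃φ∈Ωₙ =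
    ⊥-elim (consistent-disjoint limit-consistent ∃φ∈Γ' (suc (code (∃' φ)) , ∃φ∈Ωₙ))
  ... | inj₂ (c , φc∈Γₙ) = c , suc (code (∃' φ)) , φc∈Γₙ

  saturated : Saturated Γ'
  saturated = record
    { consistent = consistent-¬⊢⊥ limit-consistent
    ; closed     = λ _ → exhaustive⇒closed limit-consistent limit-exhaustive
    ; prime      = λ _ _ → exhaustive⇒prime limit-consistent limit-exhaustive
    ; witnessed  = limit-witnessed
    }

mainTheorem13 : ExcludedMiddle 0ℓ →
    (σ' : Signature) →
    let open FOFS σ' in
    (Γ Ω : Sentences) →
    ConsistentPair Γ Ω →
    (fresh : ℕ ↣ Signature.Const σ') →
    (∀ n → FreshFor (Injection.to fresh n) (λ φ → Γ φ ⊎ Ω φ)) →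
    Σ Sentences λ Γ' →
    Saturated Γ' × (∀ φ → Γ φ → Γ' φ) × (∀ φ → Ω φ → Γ' φ → ⊥)
mainTheorem13 em σ' Γ Ω con fresh fresh-new =
  Γ' , saturated , (λ _ φ∈Γ → 0 , φ∈Γ) ,
  (λ _ φ∈Ω φ∈Γ' → consistent-disjoint limit-consistent φ∈Γ' (0 , φ∈Ω))
  where
    open Lindenbaum em σ' Γ Ω con fresh fresh-new
    open Theories σ' using (consistent-disjoint)
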